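{- For every $k\ge1$ and every sequence of integers $c_1,\ldots,c_k$, $$\mathrm{Tr}\,M_q(c_1,c_2,\ldots,c_k)=\mathrm{Tr}\,M_q(c_k,c_{k-1},\ldots,c_1).$$
   Context: $[n]_q:=\frac{1-q^n}{1-q}$ for $n\in\mathbb{Z}$, and $M_q(c_1,\ldots,c_k):=\begin{pmatrix}[c_1]_q&-q^{c_1-1}\\1&0\end{pmatrix}\begin{pmatrix}[c_2]_q&-q^{c_2-1}\\1&0\end{pmatrix}\cdots\begin{pmatrix}[c_k]_q&-q^{c_k-1}\\1&0\end{pmatrix}$, a matrix with entries in $\mathbb{Z}[q,q^{ -1}]$. -}

module Defs where

open import Data.Nat as ℕ using (ℕ; zero; suc)
open import Data.Integer as ℤ using (ℤ; +_; -[1+_]; _⊓_; ∣_∣)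
open import Data.List using (List; []; _∷_; replicate; _++_; length; lookup)
open import Data.Product using (_×_; _,_)
open import Data.Fin using (Fin)
open import Relation.Binary.PropositionalEquality using (_≡_)

-- Integer polynomials as coefficient lists (constant term first)

Poly : Set
Poly = List ℤ

addP : Poly → Poly → Poly
addP []       q        = q
addP p        []       = p
addP (a ∷ p)  (b ∷ q)  = (a ℤ.+ b) ∷ addP p q

scaleP : ℤ → Poly → Poly
scaleP c []      = []
scaleP c (a ∷ p) = (c ℤ.* a) ∷ scaleP c p

mulP : Poly → Poly → Poly
mulP []      q = []
mulP (a ∷ p) q = addP (scaleP a q) (ℤ.0ℤ ∷ mulP p q)

coeffP : Poly → ℕ → ℤ
coeffP []      _       = ℤ.0ℤ
coeffP (a ∷ p) zero    = a
coeffP (a ∷ p) (suc i) = coeffP p i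

-- Laurent polynomials in ℤ[q,q⁻¹]: a pair (e , p) denotes q^e · p(q)

Laurent : Set
Laurent = ℤ × Poly

coeff : Laurent → ℤ → ℤ
coeff (e , p) n with n ℤ.- e
... | + i    = coeffP p i
... | -[1+ _ ] = ℤ.0ℤ

_≈L_ : Laurent → Laurent → Set
a ≈L b = ∀ n → coeff a n ≡ coeff b n

-- rewrite (e , p) with a lower exponent m ≤ e
lowerTo : ℤ → Laurent → Poly
lowerTo m (e , p) = replicate ∣ e ℤ.- m ∣ ℤ.0ℤ ++ p

_+L_ : Laurent → Laurent → Laurent
a@(e₁ , _) +L b@(e₂ , _) = (e₁ ⊓ e₂) , addP (lowerTo (e₁ ⊓ e₂) a) (lowerTo (e₁ ⊓ e₂) b)

_*L_ : Laurent → Laurent → Laurent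
(e₁ , p) *L (e₂ , r) = (e₁ ℤ.+ e₂) , mulP p r

-L_ : Laurent → Laurent
-L (e , p) = e , scaleP (ℤ.- ℤ.1ℤ) p

0L 1L : Laurent
0L = ℤ.0ℤ , []
1L = ℤ.0ℤ , (ℤ.1ℤ ∷ [])

qpow : ℤ → Laurent
qpow n = n , (ℤ.1ℤ ∷ [])

ones : ℕ → Poly
ones m = replicate m ℤ.1ℤ

-- [n]_q : for n = m ≥ 0, 1 + q + ... + q^(m-1);
-- for n = -(m+1) < 0, (1 - q^n)/(1 - q) = -(q^(-1) + ... + q^n) = -q^n (1 + ... + q^m)
qint : ℤ → Laurent
qint (+ m)     = ℤ.0ℤ , ones m
qint -[1+ m ]  = -L (-[1+ m ] , ones (suc m))

record Mat : Set where
  constructor mat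
  field
    a₁₁ a₁₂ a₂₁ a₂₂ : Laurent

_·M_ : Mat → Mat → Mat
mat a b c d ·M mat a' b' c' d' =
  mat ((a *L a') +L (b *L c')) ((a *L b') +L (b *L d'))
      ((c *L a') +L (d *L c')) ((c *L b') +L (d *L d'))

idM : Mat
idM = mat 1L 0L 0L 1L

tr : Mat → Laurent
tr (mat a _ _ d) = a +L d

M₁ : ℤ → Mat
M₁ c = mat (qint c) (-L (qpow (c ℤ.- ℤ.1ℤ))) 1L 0L

Mq : List ℤ → Mat
Mq []       = idM
Mq (c ∷ cs) = M₁ c ·M Mq cs

module Submission where

-- The symmetric matrix P = [[1, 1 - q], [1 - q, -q]] intertwines every factor with its transpose,
-- P · M_q(c)ᵀ = M_q(c) · P, which amounts to the identity (1 - q)[c]_q + q^c = 1.  Transposition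
-- reverses products, so P · M_q(c₁,…,c_k)ᵀ = M_q(c_k,…,c₁) · P.  Multiplying on the left by adj P
-- and taking traces gives det P · Tr M_q(c₁,…,c_k) = det P · Tr M_q(c_k,…,c₁), and det P = -(1 - q + q²)
-- has a nonzero lowest coefficient, so it is not a zero divisor in ℤ[q,q⁻¹] and cancels.

open import Defs
open import Data.Integer using (ℤ)
open import Data.List using (List; reverse; length)
open import Data.Nat using (_≥_)

module LaurentRing where

  open import Data.Nat using (ℕ; zero; suc)
  open import Data.Integer using (+_; -[1+_]; _+_; _*_; -_; _-_; 0ℤ; 1ℤ; _⊓_; ∣_∣; NonZero) renaming (_≤_ to _ℤ≤_)
  import Data.Integer.Properties as ℤP
  open import Data.Integer.Tactic.RingSolver using (solve-∀)
  open import Data.List using ([]; _∷_; replicate; _++_)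
  open import Data.Product using (_,_)
  open import Relation.Binary.PropositionalEquality
  open import Relation.Binary.Bundles using (Setoid)
  open import Level using (0ℓ)
  open import Algebra.Bundles using (CommutativeRing)
  open import Algebra.Consequences.Setoid using (comm∧idˡ⇒id; comm∧invˡ⇒inv; comm∧distrˡ⇒distr)
  import Relation.Binary.Reasoning.Setoid as SetoidReasoning
  open import Data.Maybe as Maybe using (Maybe)
  open import Relation.Nullary.Decidable.Core using (dec⇒maybe)
  open import Data.List.Relation.Unary.All using (All; all?; []; _∷_)
  open import Data.Integer.Properties using (_≟_)
  open import Tactic.RingSolver.Core.AlmostCommutativeRing using (AlmostCommutativeRing; fromCommutativeRing)

  -- Polynomials

  -- Coefficientwise equality, as a record so that Agda can infer the polynomials from a proof.
  infix 4 _≈P_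
  record _≈P_ (p r : Poly) : Set where
    constructor coeffwise
    field coeffP-≡ : ∀ i → coeffP p i ≡ coeffP r i
  open _≈P_ public

  ≈P-setoid : Setoid 0ℓ 0ℓ
  ≈P-setoid = record
    { Carrier       = Poly
    ; _≈_           = _≈P_
    ; isEquivalence = record
      { refl  = coeffwise λ i → refl
      ; sym   = λ e → coeffwise λ i → sym (coeffP-≡ e i)
      ; trans = λ e f → coeffwise λ i → trans (coeffP-≡ e i) (coeffP-≡ f i)
      }
    }

  open Setoid ≈P-setoid using () renaming (refl to ≈P-refl; sym to ≈P-sym; trans to ≈P-trans)

  module ≈P-Reasoning = SetoidReasoning ≈P-setoid

  tailP : Poly → Poly
  tailP []      = []
  tailP (_ ∷ p) = p

  coeffP-tailP : ∀ p i → coeffP (tailP p) i ≡ coeffP p (suc i)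
  coeffP-tailP []      i = refl
  coeffP-tailP (a ∷ p) i = refl

  tailP-cong : ∀ {p r} → p ≈P r → tailP p ≈P tailP r
  tailP-cong {p} {r} e .coeffP-≡ i = trans (coeffP-tailP p i) (trans (e .coeffP-≡ (suc i)) (sym (coeffP-tailP r i)))

  ∷-cong : ∀ {a b p r} → a ≡ b → p ≈P r → a ∷ p ≈P b ∷ r
  ∷-cong a≡b e .coeffP-≡ zero    = a≡b
  ∷-cong a≡b e .coeffP-≡ (suc i) = e .coeffP-≡ i

  coeffP-addP : ∀ p r i → coeffP (addP p r) i ≡ coeffP p i + coeffP r i
  coeffP-addP []      r       i       = sym (ℤP.+-identityˡ _)
  coeffP-addP (a ∷ p) []      i       = sym (ℤP.+-identityʳ _)
  coeffP-addP (a ∷ p) (b ∷ r) zero    = refl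
  coeffP-addP (a ∷ p) (b ∷ r) (suc i) = coeffP-addP p r i

  coeffP-scaleP : ∀ c p i → coeffP (scaleP c p) i ≡ c * coeffP p i
  coeffP-scaleP c []      i       = sym (ℤP.*-zeroʳ c)
  coeffP-scaleP c (a ∷ p) zero    = refl
  coeffP-scaleP c (a ∷ p) (suc i) = coeffP-scaleP c p i

  addP-cong : ∀ {p p' r r'} → p ≈P p' → r ≈P r' → addP p r ≈P addP p' r'
  addP-cong {p} {p'} {r} {r'} e f .coeffP-≡ i =
    trans (coeffP-addP p r i) (trans (cong₂ _+_ (e .coeffP-≡ i) (f .coeffP-≡ i)) (sym (coeffP-addP p' r' i)))

  addP-congʳ : ∀ p {r r'} → r ≈P r' → addP p r ≈P addP p r'
  addP-congʳ p = addP-cong (≈P-refl {p})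

  addP-comm : ∀ p r → addP p r ≈P addP r p
  addP-comm p r .coeffP-≡ i =
    trans (coeffP-addP p r i) (trans (ℤP.+-comm (coeffP p i) _) (sym (coeffP-addP r p i)))

  addP-assoc : ∀ p r s → addP (addP p r) s ≈P addP p (addP r s)
  addP-assoc p r s .coeffP-≡ i = begin
    coeffP (addP (addP p r) s) i             ≡⟨ coeffP-addP (addP p r) s i ⟩
    coeffP (addP p r) i + coeffP s i         ≡⟨ cong (_+ coeffP s i) (coeffP-addP p r i) ⟩
    coeffP p i + coeffP r i + coeffP s i     ≡⟨ ℤP.+-assoc (coeffP p i) _ _ ⟩
    coeffP p i + (coeffP r i + coeffP s i)   ≡⟨ cong (_+_ (coeffP p i)) (coeffP-addP r s i) ⟨
    coeffP p i + coeffP (addP r s) i         ≡⟨ coeffP-addP p (addP r s) i ⟨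
    coeffP (addP p (addP r s)) i             ∎
    where open ≡-Reasoning

  addP-interchange : ∀ p r s t → addP (addP p r) (addP s t) ≈P addP (addP p s) (addP r t)
  addP-interchange p r s t .coeffP-≡ i = begin
    coeffP (addP (addP p r) (addP s t)) i                    ≡⟨ expand p r s t ⟩
    coeffP p i + coeffP r i + (coeffP s i + coeffP t i)      ≡⟨ interchange (coeffP p i) _ _ _ ⟩
    coeffP p i + coeffP s i + (coeffP r i + coeffP t i)      ≡⟨ expand p s r t ⟨
    coeffP (addP (addP p s) (addP r t)) i                    ∎
    where
    open ≡-Reasoning
    expand : ∀ p r s t →
      coeffP (addP (addP p r) (addP s t)) i ≡ coeffP p i + coeffP r i + (coeffP s i + coeffP t i)
    expand p r s t = trans (coeffP-addP (addP p r) _ i) (cong₂ _+_ (coeffP-addP p r i) (coeffP-addP s t i))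
    interchange : ∀ a b c d → a + b + (c + d) ≡ a + c + (b + d)
    interchange = solve-∀

  scaleP-zeroˡ : ∀ p → scaleP 0ℤ p ≈P []
  scaleP-zeroˡ p .coeffP-≡ i = trans (coeffP-scaleP 0ℤ p i) (ℤP.*-zeroˡ (coeffP p i))

  scaleP-addP : ∀ c p r → scaleP c (addP p r) ≈P addP (scaleP c p) (scaleP c r)
  scaleP-addP c p r .coeffP-≡ i = begin
    coeffP (scaleP c (addP p r)) i
      ≡⟨ coeffP-scaleP c (addP p r) i ⟩
    c * coeffP (addP p r) i
      ≡⟨ cong (c *_) (coeffP-addP p r i) ⟩
    c * (coeffP p i + coeffP r i)
      ≡⟨ ℤP.*-distribˡ-+ c (coeffP p i) _ ⟩
    c * coeffP p i + c * coeffP r i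
      ≡⟨ cong₂ _+_ (coeffP-scaleP c p i) (coeffP-scaleP c r i) ⟨
    coeffP (scaleP c p) i + coeffP (scaleP c r) i
      ≡⟨ coeffP-addP (scaleP c p) _ i ⟨
    coeffP (addP (scaleP c p) (scaleP c r)) i ∎
    where open ≡-Reasoning

  scaleP-assoc : ∀ c d p → scaleP (c * d) p ≈P scaleP c (scaleP d p)
  scaleP-assoc c d p .coeffP-≡ i = begin
    coeffP (scaleP (c * d) p) i      ≡⟨ coeffP-scaleP (c * d) p i ⟩
    c * d * coeffP p i               ≡⟨ ℤP.*-assoc c d _ ⟩
    c * (d * coeffP p i)             ≡⟨ cong (c *_) (coeffP-scaleP d p i) ⟨
    c * coeffP (scaleP d p) i        ≡⟨ coeffP-scaleP c (scaleP d p) i ⟨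
    coeffP (scaleP c (scaleP d p)) i ∎
    where open ≡-Reasoning

  coeffP-mulP-zero : ∀ p r → coeffP (mulP p r) 0 ≡ coeffP p 0 * coeffP r 0
  coeffP-mulP-zero []      r = sym (ℤP.*-zeroˡ (coeffP r 0))
  coeffP-mulP-zero (a ∷ p) r =
    trans (coeffP-addP (scaleP a r) _ 0) (trans (ℤP.+-identityʳ _) (coeffP-scaleP a r 0))

  coeffP-mulP-suc : ∀ p r i →
    coeffP (mulP p r) (suc i) ≡ coeffP p 0 * coeffP r (suc i) + coeffP (mulP (tailP p) r) i
  coeffP-mulP-suc []      r i = sym (trans (ℤP.+-identityʳ _) (ℤP.*-zeroˡ (coeffP r (suc i))))
  coeffP-mulP-suc (a ∷ p) r i =
    trans (coeffP-addP (scaleP a r) _ (suc i)) (cong (_+ coeffP (mulP p r) i) (coeffP-scaleP a r (suc i)))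

  mulP-congˡ : ∀ {p p'} r → p ≈P p' → mulP p r ≈P mulP p' r
  mulP-congˡ {p} {p'} r e .coeffP-≡ zero = begin
    coeffP (mulP p r) 0          ≡⟨ coeffP-mulP-zero p r ⟩
    coeffP p 0 * coeffP r 0      ≡⟨ cong (_* coeffP r 0) (e .coeffP-≡ 0) ⟩
    coeffP p' 0 * coeffP r 0     ≡⟨ coeffP-mulP-zero p' r ⟨
    coeffP (mulP p' r) 0         ∎
    where open ≡-Reasoning
  mulP-congˡ {p} {p'} r e .coeffP-≡ (suc i) = begin
    coeffP (mulP p r) (suc i)
      ≡⟨ coeffP-mulP-suc p r i ⟩
    coeffP p 0 * coeffP r (suc i) + coeffP (mulP (tailP p) r) i
      ≡⟨ cong₂ (λ x y → x * coeffP r (suc i) + y) (e .coeffP-≡ 0) (mulP-congˡ r (tailP-cong e) .coeffP-≡ i) ⟩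
    coeffP p' 0 * coeffP r (suc i) + coeffP (mulP (tailP p') r) i
      ≡⟨ coeffP-mulP-suc p' r i ⟨
    coeffP (mulP p' r) (suc i) ∎
    where open ≡-Reasoning

  mulP-zeroʳ : ∀ p → mulP p [] ≈P []
  mulP-zeroʳ []      .coeffP-≡ i       = refl
  mulP-zeroʳ (a ∷ p) .coeffP-≡ zero    = refl
  mulP-zeroʳ (a ∷ p) .coeffP-≡ (suc i) = mulP-zeroʳ p .coeffP-≡ i

  0∷[]≈P[] : 0ℤ ∷ [] ≈P []
  0∷[]≈P[] .coeffP-≡ zero    = refl
  0∷[]≈P[] .coeffP-≡ (suc i) = refl

  mulP-0∷ : ∀ p r → mulP (0ℤ ∷ p) r ≈P 0ℤ ∷ mulP p r
  mulP-0∷ p r = addP-cong (scaleP-zeroˡ r) (≈P-refl {0ℤ ∷ mulP p r})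

  mulP-consʳ : ∀ p b r → mulP p (b ∷ r) ≈P addP (scaleP b p) (0ℤ ∷ mulP p r)
  mulP-consʳ []      b r = ≈P-sym 0∷[]≈P[]
  mulP-consʳ (a ∷ p) b r = ∷-cong (cong (_+ 0ℤ) (ℤP.*-comm a b)) (begin
    addP (scaleP a r) (mulP p (b ∷ r))
      ≈⟨ addP-congʳ (scaleP a r) (mulP-consʳ p b r) ⟩
    addP (scaleP a r) (addP (scaleP b p) (0ℤ ∷ mulP p r))
      ≈⟨ addP-assoc (scaleP a r) _ _ ⟨
    addP (addP (scaleP a r) (scaleP b p)) (0ℤ ∷ mulP p r)
      ≈⟨ addP-cong (addP-comm (scaleP a r) _) ≈P-refl ⟩
    addP (addP (scaleP b p) (scaleP a r)) (0ℤ ∷ mulP p r)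
      ≈⟨ addP-assoc (scaleP b p) _ _ ⟩
    addP (scaleP b p) (addP (scaleP a r) (0ℤ ∷ mulP p r)) ∎)
    where open ≈P-Reasoning

  mulP-comm : ∀ p r → mulP p r ≈P mulP r p
  mulP-comm []      r = ≈P-sym (mulP-zeroʳ r)
  mulP-comm (a ∷ p) r = ≈P-trans (addP-congʳ (scaleP a r) (∷-cong refl (mulP-comm p r))) (≈P-sym (mulP-consʳ r a p))

  mulP-congʳ : ∀ p {r r'} → r ≈P r' → mulP p r ≈P mulP p r'
  mulP-congʳ p {r} {r'} e = ≈P-trans (mulP-comm p r) (≈P-trans (mulP-congˡ p e) (mulP-comm r' p))

  mulP-distribˡ : ∀ p r s → mulP p (addP r s) ≈P addP (mulP p r) (mulP p s)
  mulP-distribˡ []      r s = ≈P-refl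
  mulP-distribˡ (a ∷ p) r s = begin
    addP (scaleP a (addP r s)) (0ℤ ∷ mulP p (addP r s))
      ≈⟨ addP-cong (scaleP-addP a r s) (∷-cong refl (mulP-distribˡ p r s)) ⟩
    addP (addP (scaleP a r) (scaleP a s)) (addP (0ℤ ∷ mulP p r) (0ℤ ∷ mulP p s))
      ≈⟨ addP-interchange (scaleP a r) _ _ _ ⟩
    addP (addP (scaleP a r) (0ℤ ∷ mulP p r)) (addP (scaleP a s) (0ℤ ∷ mulP p s)) ∎
    where open ≈P-Reasoning

  mulP-distribʳ : ∀ p r s → mulP (addP p r) s ≈P addP (mulP p s) (mulP r s)
  mulP-distribʳ p r s = begin
    mulP (addP p r) s              ≈⟨ mulP-comm (addP p r) s ⟩
    mulP s (addP p r)              ≈⟨ mulP-distribˡ s p r ⟩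
    addP (mulP s p) (mulP s r)     ≈⟨ addP-cong (mulP-comm s p) (mulP-comm s r) ⟩
    addP (mulP p s) (mulP r s)     ∎
    where open ≈P-Reasoning

  mulP-scaleˡ : ∀ c p r → mulP (scaleP c p) r ≈P scaleP c (mulP p r)
  mulP-scaleˡ c []      r = ≈P-refl
  mulP-scaleˡ c (a ∷ p) r = begin
    addP (scaleP (c * a) r) (0ℤ ∷ mulP (scaleP c p) r)
      ≈⟨ addP-cong (scaleP-assoc c a r) (∷-cong (sym (ℤP.*-zeroʳ c)) (mulP-scaleˡ c p r)) ⟩
    addP (scaleP c (scaleP a r)) (scaleP c (0ℤ ∷ mulP p r))
      ≈⟨ scaleP-addP c (scaleP a r) _ ⟨
    scaleP c (addP (scaleP a r) (0ℤ ∷ mulP p r)) ∎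
    where open ≈P-Reasoning

  mulP-assoc : ∀ p r s → mulP (mulP p r) s ≈P mulP p (mulP r s)
  mulP-assoc []      r s = ≈P-refl
  mulP-assoc (a ∷ p) r s = begin
    mulP (addP (scaleP a r) (0ℤ ∷ mulP p r)) s
      ≈⟨ mulP-distribʳ (scaleP a r) _ s ⟩
    addP (mulP (scaleP a r) s) (mulP (0ℤ ∷ mulP p r) s)
      ≈⟨ addP-cong (mulP-scaleˡ a r s) (mulP-0∷ (mulP p r) s) ⟩
    addP (scaleP a (mulP r s)) (0ℤ ∷ mulP (mulP p r) s)
      ≈⟨ addP-congʳ (scaleP a (mulP r s)) (∷-cong refl (mulP-assoc p r s)) ⟩
    addP (scaleP a (mulP r s)) (0ℤ ∷ mulP p (mulP r s)) ∎
    where open ≈P-Reasoning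

  mulP-identityˡ : ∀ p → mulP (1ℤ ∷ []) p ≈P p
  mulP-identityˡ p .coeffP-≡ i = begin
    coeffP (addP (scaleP 1ℤ p) (0ℤ ∷ [])) i       ≡⟨ coeffP-addP (scaleP 1ℤ p) _ i ⟩
    coeffP (scaleP 1ℤ p) i + coeffP (0ℤ ∷ []) i   ≡⟨ cong₂ _+_ (coeffP-scaleP 1ℤ p i) (0∷[]≈P[] .coeffP-≡ i) ⟩
    1ℤ * coeffP p i + 0ℤ                          ≡⟨ trans (ℤP.+-identityʳ _) (ℤP.*-identityˡ _) ⟩
    coeffP p i                                    ∎
    where open ≡-Reasoning

  ≈P-head∷tail : ∀ p → p ≈P coeffP p 0 ∷ tailP p
  ≈P-head∷tail p .coeffP-≡ zero    = refl
  ≈P-head∷tail p .coeffP-≡ (suc i) = sym (coeffP-tailP p i)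

  mulP-0∷ʳ : ∀ p r → mulP p (0ℤ ∷ r) ≈P 0ℤ ∷ mulP p r
  mulP-0∷ʳ p r = ≈P-trans (mulP-consʳ p 0ℤ r) (addP-cong (scaleP-zeroˡ p) (≈P-refl {0ℤ ∷ mulP p r}))

  module _ (a : ℤ) .{{_ : NonZero a}} (r : Poly) where

    private
      head-zero : ∀ p → mulP (a ∷ r) p ≈P [] → coeffP p 0 ≡ 0ℤ
      head-zero p h = ℤP.*-cancelˡ-≡ a (coeffP p 0) 0ℤ (begin
        a * coeffP p 0             ≡⟨ coeffP-mulP-zero (a ∷ r) p ⟨
        coeffP (mulP (a ∷ r) p) 0  ≡⟨ h .coeffP-≡ 0 ⟩
        0ℤ                         ≡⟨ ℤP.*-zeroʳ a ⟨
        a * 0ℤ                     ∎)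
        where open ≡-Reasoning

      tail-zero : ∀ p → mulP (a ∷ r) p ≈P [] → mulP (a ∷ r) (tailP p) ≈P []
      tail-zero p h = coeffwise λ i → trans (shifted .coeffP-≡ (suc i)) (h .coeffP-≡ (suc i))
        where
        open ≈P-Reasoning
        shifted : 0ℤ ∷ mulP (a ∷ r) (tailP p) ≈P mulP (a ∷ r) p
        shifted = begin
          0ℤ ∷ mulP (a ∷ r) (tailP p)
            ≈⟨ mulP-0∷ʳ (a ∷ r) (tailP p) ⟨
          mulP (a ∷ r) (0ℤ ∷ tailP p)
            ≈⟨ mulP-congʳ (a ∷ r) (∷-cong (sym (head-zero p h)) (≈P-refl {tailP p})) ⟩
          mulP (a ∷ r) (coeffP p 0 ∷ tailP p) ≈⟨ mulP-congʳ (a ∷ r) (≈P-head∷tail p) ⟨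
          mulP (a ∷ r) p ∎

    mulP-cancelˡ-zero : ∀ p → mulP (a ∷ r) p ≈P [] → p ≈P []
    mulP-cancelˡ-zero p h .coeffP-≡ zero    = head-zero p h
    mulP-cancelˡ-zero p h .coeffP-≡ (suc i) =
      trans (sym (coeffP-tailP p i)) (mulP-cancelˡ-zero (tailP p) (tail-zero p h) .coeffP-≡ i)

  coeffPℤ : Poly → ℤ → ℤ
  coeffPℤ p (+ i)    = coeffP p i
  coeffPℤ p -[1+ _ ] = 0ℤ

  coeff-coeffPℤ : ∀ e p n → coeff (e , p) n ≡ coeffPℤ p (n - e)
  coeff-coeffPℤ e p n with n - e
  ... | + i      = refl
  ... | -[1+ _ ] = refl

  coeffPℤ-cong : ∀ {p r} → p ≈P r → ∀ d → coeffPℤ p d ≡ coeffPℤ r d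
  coeffPℤ-cong e (+ i)    = e .coeffP-≡ i
  coeffPℤ-cong e -[1+ _ ] = refl

  coeffPℤ-addP : ∀ p r d → coeffPℤ (addP p r) d ≡ coeffPℤ p d + coeffPℤ r d
  coeffPℤ-addP p r (+ i)    = coeffP-addP p r i
  coeffPℤ-addP p r -[1+ _ ] = refl

  coeffPℤ-scaleP : ∀ c p d → coeffPℤ (scaleP c p) d ≡ c * coeffPℤ p d
  coeffPℤ-scaleP c p (+ i)    = coeffP-scaleP c p i
  coeffPℤ-scaleP c p -[1+ _ ] = sym (ℤP.*-zeroʳ c)

  coeffPℤ-[] : ∀ d → coeffPℤ [] d ≡ 0ℤ
  coeffPℤ-[] (+ i)    = refl
  coeffPℤ-[] -[1+ _ ] = refl

  shiftP : ℕ → Poly → Poly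
  shiftP k p = replicate k 0ℤ ++ p

  coeffPℤ-shiftP : ∀ k p d → coeffPℤ (shiftP k p) d ≡ coeffPℤ p (d - + k)
  coeffPℤ-shiftP zero    p d          = cong (coeffPℤ p) (sym (ℤP.+-identityʳ d))
  coeffPℤ-shiftP (suc k) p (+ zero)   = refl
  coeffPℤ-shiftP (suc k) p (+ suc i)  = trans (coeffPℤ-shiftP k p (+ i)) (cong (coeffPℤ p) (shift-sub (+ i) (+ k)))
    where
    shift-sub : ∀ a b → a - b ≡ (1ℤ + a) - (1ℤ + b)
    shift-sub = solve-∀
  coeffPℤ-shiftP (suc k) p -[1+ _ ]   = refl

  mulP-shiftPˡ : ∀ k p r → mulP (shiftP k p) r ≈P shiftP k (mulP p r)
  mulP-shiftPˡ zero    p r = ≈P-refl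
  mulP-shiftPˡ (suc k) p r = ≈P-trans (mulP-0∷ (shiftP k p) r) (∷-cong refl (mulP-shiftPˡ k p r))

  -- Laurent polynomials

  -- The coefficientwise equality _≈L_, wrapped for the same reason as _≈P_.
  infix 4 _≈_
  record _≈_ (a b : Laurent) : Set where
    constructor coeffwiseL
    field coeff-≡ : a ≈L b
  open _≈_ public

  ≈-setoid : Setoid 0ℓ 0ℓ
  ≈-setoid = record
    { Carrier       = Laurent
    ; _≈_           = _≈_
    ; isEquivalence = record
      { refl  = coeffwiseL λ n → refl
      ; sym   = λ e → coeffwiseL λ n → sym (e .coeff-≡ n)
      ; trans = λ e f → coeffwiseL λ n → trans (e .coeff-≡ n) (f .coeff-≡ n)
      }
    }

  open Setoid ≈-setoid using () renaming (sym to ≈-sym; trans to ≈-trans)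

  module ≈-Reasoning = SetoidReasoning ≈-setoid

  ,-cong : ∀ {e e' p p'} → e ≡ e' → p ≈P p' → (e , p) ≈ (e' , p')
  ,-cong {e} {p = p} {p'} refl q .coeff-≡ n =
    trans (coeff-coeffPℤ e p n) (trans (coeffPℤ-cong q (n - e)) (sym (coeff-coeffPℤ e p' n)))

  ,-injectiveʳ : ∀ e {p p'} → (e , p) ≈ (e , p') → p ≈P p'
  ,-injectiveʳ e {p} {p'} q .coeffP-≡ i = begin
    coeffP p i                   ≡⟨ cong (coeffPℤ p) (offset e (+ i)) ⟨
    coeffPℤ p (e + + i - e)      ≡⟨ coeff-coeffPℤ e p (e + + i) ⟨
    coeff (e , p) (e + + i)      ≡⟨ q .coeff-≡ (e + + i) ⟩
    coeff (e , p') (e + + i)     ≡⟨ coeff-coeffPℤ e p' (e + + i) ⟩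
    coeffPℤ p' (e + + i - e)     ≡⟨ cong (coeffPℤ p') (offset e (+ i)) ⟩
    coeffP p' i                  ∎
    where
    open ≡-Reasoning
    offset : ∀ e d → e + d - e ≡ d
    offset = solve-∀

  ,-congʳ : ∀ e {p p'} → p ≈P p' → (e , p) ≈ (e , p')
  ,-congʳ e = ,-cong refl

  ≈-shiftP : ∀ e k p → (e , shiftP k p) ≈ (e + + k , p)
  ≈-shiftP e k p .coeff-≡ n = begin
    coeff (e , shiftP k p) n      ≡⟨ coeff-coeffPℤ e (shiftP k p) n ⟩
    coeffPℤ (shiftP k p) (n - e)  ≡⟨ coeffPℤ-shiftP k p (n - e) ⟩
    coeffPℤ p (n - e - + k)       ≡⟨ cong (coeffPℤ p) (sub-sub n e (+ k)) ⟩
    coeffPℤ p (n - (e + + k))     ≡⟨ coeff-coeffPℤ (e + + k) p n ⟨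
    coeff (e + + k , p) n         ∎
    where
    open ≡-Reasoning
    sub-sub : ∀ n e k → n - e - k ≡ n - (e + k)
    sub-sub = solve-∀

  +∣e-m∣ : ∀ {m e} → m ℤ≤ e → m + + ∣ e - m ∣ ≡ e
  +∣e-m∣ {m} {e} m≤e = trans (cong (_+_ m) (ℤP.0≤i⇒+∣i∣≡i (ℤP.i≤j⇒0≤j-i m≤e))) (add-sub m e)
    where
    add-sub : ∀ m e → m + (e - m) ≡ e
    add-sub = solve-∀

  ≈-lowerTo : ∀ {m e} p → m ℤ≤ e → (m , lowerTo m (e , p)) ≈ (e , p)
  ≈-lowerTo {m} {e} p m≤e = ≈-trans (≈-shiftP m ∣ e - m ∣ p) (,-cong (+∣e-m∣ m≤e) ≈P-refl)

  coeff-,addP : ∀ e p r n → coeff (e , addP p r) n ≡ coeff (e , p) n + coeff (e , r) n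
  coeff-,addP e p r n = begin
    coeff (e , addP p r) n                      ≡⟨ coeff-coeffPℤ e (addP p r) n ⟩
    coeffPℤ (addP p r) (n - e)                  ≡⟨ coeffPℤ-addP p r (n - e) ⟩
    coeffPℤ p (n - e) + coeffPℤ r (n - e)       ≡⟨ cong₂ _+_ (coeff-coeffPℤ e p n) (coeff-coeffPℤ e r n) ⟨
    coeff (e , p) n + coeff (e , r) n           ∎
    where open ≡-Reasoning

  coeff-+L : ∀ a b n → coeff (a +L b) n ≡ coeff a n + coeff b n
  coeff-+L (e , p) (f , r) n = trans (coeff-,addP (e ⊓ f) _ _ n)
    (cong₂ _+_ (≈-lowerTo p (ℤP.i⊓j≤i e f) .coeff-≡ n) (≈-lowerTo r (ℤP.i⊓j≤j e f) .coeff-≡ n))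

  coeff--L : ∀ a n → coeff (-L a) n ≡ - coeff a n
  coeff--L (e , p) n = begin
    coeff (e , scaleP (- 1ℤ) p) n          ≡⟨ coeff-coeffPℤ e _ n ⟩
    coeffPℤ (scaleP (- 1ℤ) p) (n - e)      ≡⟨ coeffPℤ-scaleP (- 1ℤ) p (n - e) ⟩
    - 1ℤ * coeffPℤ p (n - e)               ≡⟨ ℤP.-1*i≡-i _ ⟩
    - coeffPℤ p (n - e)                    ≡⟨ cong -_ (coeff-coeffPℤ e p n) ⟨
    - coeff (e , p) n                      ∎
    where open ≡-Reasoning

  coeff-0L : ∀ n → coeff 0L n ≡ 0ℤ
  coeff-0L n = trans (coeff-coeffPℤ 0ℤ [] n) (coeffPℤ-[] (n - 0ℤ))

  *L-lowerTo : ∀ {m e} p b → m ℤ≤ e → (m , lowerTo m (e , p)) *L b ≈ (e , p) *L b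
  *L-lowerTo {m} {e} p (f , r) m≤e = begin
    (m + f , mulP (shiftP k p) r)     ≈⟨ ,-cong refl (mulP-shiftPˡ k p r) ⟩
    (m + f , shiftP k (mulP p r))     ≈⟨ ≈-shiftP (m + f) k (mulP p r) ⟩
    (m + f + + k , mulP p r)          ≈⟨ ,-cong exponent ≈P-refl ⟩
    (e + f , mulP p r)                ∎
    where
    open ≈-Reasoning
    k = ∣ e - m ∣
    swap : ∀ m f k → m + f + k ≡ m + k + f
    swap = solve-∀
    exponent : m + f + + k ≡ e + f
    exponent = trans (swap m f (+ k)) (cong (_+ f) (+∣e-m∣ m≤e))

  *L-congˡ : ∀ a a' b → a ≈ a' → a *L b ≈ a' *L b
  *L-congˡ (e , p) (e' , p') b@(f , r) q = begin
    (e , p) *L b      ≈⟨ *L-lowerTo p b (ℤP.i⊓j≤i e e') ⟨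
    (m , La) *L b     ≈⟨ ,-cong refl (mulP-congˡ r La≈La') ⟩
    (m , La') *L b    ≈⟨ *L-lowerTo p' b (ℤP.i⊓j≤j e e') ⟩
    (e' , p') *L b    ∎
    where
    open ≈-Reasoning
    m = e ⊓ e'
    La = lowerTo m (e , p)
    La' = lowerTo m (e' , p')
    La≈La' : La ≈P La'
    La≈La' = ,-injectiveʳ m (≈-trans (≈-lowerTo p (ℤP.i⊓j≤i e e')) (≈-trans q (≈-sym (≈-lowerTo p' (ℤP.i⊓j≤j e e')))))

  *L-comm : ∀ a b → a *L b ≈ b *L a
  *L-comm (e , p) (f , r) = ,-cong (ℤP.+-comm e f) (mulP-comm p r)

  *L-congʳ : ∀ a b b' → b ≈ b' → a *L b ≈ a *L b'
  *L-congʳ a b b' q = ≈-trans (*L-comm a b) (≈-trans (*L-congˡ b b' a q) (*L-comm b' a))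

  *L-assoc : ∀ a b c → (a *L b) *L c ≈ a *L (b *L c)
  *L-assoc (e , p) (f , r) (g , s) = ,-cong (ℤP.+-assoc e f g) (mulP-assoc p r s)

  *L-identityˡ : ∀ a → 1L *L a ≈ a
  *L-identityˡ (e , p) = ,-cong (ℤP.+-identityˡ e) (mulP-identityˡ p)

  *L-distribˡ : ∀ a b c → a *L (b +L c) ≈ (a *L b) +L (a *L c)
  *L-distribˡ a@(e , p) b@(f , r) c@(g , s) .coeff-≡ n = begin
    coeff (e + m , mulP p (addP Lb Lc)) n
      ≡⟨ ,-congʳ (e + m) (mulP-distribˡ p Lb Lc) .coeff-≡ n ⟩
    coeff (e + m , addP (mulP p Lb) (mulP p Lc)) n
      ≡⟨ coeff-,addP (e + m) _ _ n ⟩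
    coeff (a *L (m , Lb)) n + coeff (a *L (m , Lc)) n
      ≡⟨ cong₂ _+_ (*L-congʳ a _ b (≈-lowerTo r (ℤP.i⊓j≤i f g)) .coeff-≡ n)
                   (*L-congʳ a _ c (≈-lowerTo s (ℤP.i⊓j≤j f g)) .coeff-≡ n) ⟩
    coeff (a *L b) n + coeff (a *L c) n
      ≡⟨ coeff-+L (a *L b) (a *L c) n ⟨
    coeff ((a *L b) +L (a *L c)) n ∎
    where
    open ≡-Reasoning
    m = f ⊓ g
    Lb = lowerTo m b
    Lc = lowerTo m c

  +L-cong : ∀ {a a' b b'} → a ≈ a' → b ≈ b' → a +L b ≈ a' +L b'
  +L-cong {a} {a'} {b} {b'} e f .coeff-≡ n =
    trans (coeff-+L a b n) (trans (cong₂ _+_ (e .coeff-≡ n) (f .coeff-≡ n)) (sym (coeff-+L a' b' n)))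

  +L-assoc : ∀ a b c → (a +L b) +L c ≈ a +L (b +L c)
  +L-assoc a b c .coeff-≡ n = begin
    coeff ((a +L b) +L c) n
      ≡⟨ trans (coeff-+L (a +L b) c n) (cong (_+ coeff c n) (coeff-+L a b n)) ⟩
    coeff a n + coeff b n + coeff c n
      ≡⟨ ℤP.+-assoc (coeff a n) _ _ ⟩
    coeff a n + (coeff b n + coeff c n)
      ≡⟨ trans (coeff-+L a (b +L c) n) (cong (_+_ (coeff a n)) (coeff-+L b c n)) ⟨
    coeff (a +L (b +L c)) n ∎
    where open ≡-Reasoning

  +L-comm : ∀ a b → a +L b ≈ b +L a
  +L-comm a b .coeff-≡ n = trans (coeff-+L a b n) (trans (ℤP.+-comm (coeff a n) _) (sym (coeff-+L b a n)))

  +L-identityˡ : ∀ a → 0L +L a ≈ a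
  +L-identityˡ a .coeff-≡ n = trans (coeff-+L 0L a n) (trans (cong (_+ coeff a n) (coeff-0L n)) (ℤP.+-identityˡ _))

  -L-inverseˡ : ∀ a → (-L a) +L a ≈ 0L
  -L-inverseˡ a .coeff-≡ n = begin
    coeff ((-L a) +L a) n       ≡⟨ coeff-+L (-L a) a n ⟩
    coeff (-L a) n + coeff a n  ≡⟨ cong (_+ coeff a n) (coeff--L a n) ⟩
    - coeff a n + coeff a n     ≡⟨ ℤP.+-inverseˡ (coeff a n) ⟩
    0ℤ                          ≡⟨ coeff-0L n ⟨
    coeff 0L n                  ∎
    where open ≡-Reasoning

  -L-cong : ∀ {a a'} → a ≈ a' → -L a ≈ -L a'
  -L-cong {a} {a'} e .coeff-≡ n = trans (coeff--L a n) (trans (cong -_ (e .coeff-≡ n)) (sym (coeff--L a' n)))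

  *L-cong : ∀ {a a' b b'} → a ≈ a' → b ≈ b' → a *L b ≈ a' *L b'
  *L-cong {a} {a'} {b} {b'} e f = ≈-trans (*L-congˡ a a' b e) (*L-congʳ a' b b' f)

  Laurent-commutativeRing : CommutativeRing 0ℓ 0ℓ
  Laurent-commutativeRing = record
    { Carrier           = Laurent
    ; _≈_               = _≈_
    ; _+_               = _+L_
    ; _*_               = _*L_
    ; -_                = -L_
    ; 0#                = 0L
    ; 1#                = 1L
    ; isCommutativeRing = record
      { isRing = record
        { +-isAbelianGroup = record
          { isGroup = record
            { isMonoid = record
              { isSemigroup = record
                { isMagma = record
                  { isEquivalence = Setoid.isEquivalence ≈-setoid
                  ; ∙-cong        = +L-cong
                  }
                ; assoc = +L-assoc
                }
              ; identity = comm∧idˡ⇒id ≈-setoid +L-comm +L-identityˡ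
              }
            ; inverse = comm∧invˡ⇒inv ≈-setoid +L-comm -L-inverseˡ
            ; ⁻¹-cong = -L-cong
            }
          ; comm = +L-comm
          }
        ; *-cong     = *L-cong
        ; *-assoc    = *L-assoc
        ; *-identity = comm∧idˡ⇒id ≈-setoid *L-comm *L-identityˡ
        ; distrib    = comm∧distrˡ⇒distr ≈-setoid +L-cong *L-comm *L-distribˡ
        }
      ; *-comm = *L-comm
      }
    }

  ,≈0L : ∀ e {p} → p ≈P [] → (e , p) ≈ 0L
  ,≈0L e {p} z .coeff-≡ n = begin
    coeff (e , p) n       ≡⟨ coeff-coeffPℤ e p n ⟩
    coeffPℤ p (n - e)     ≡⟨ coeffPℤ-cong z (n - e) ⟩
    coeffPℤ [] (n - e)    ≡⟨ coeffPℤ-[] (n - e) ⟩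
    0ℤ                    ≡⟨ coeff-0L n ⟨
    coeff 0L n            ∎
    where open ≡-Reasoning

  0L≟_ : ∀ x → Maybe (0L ≈ x)
  0L≟ (e , p) = Maybe.map (λ z → ≈-sym (,≈0L e (allZero z))) (dec⇒maybe (all? (_≟ 0ℤ) p))
    where
    allZero : ∀ {p} → All (_≡ 0ℤ) p → p ≈P []
    allZero []                             = ≈P-refl
    allZero (a≡0 ∷ as≡0) .coeffP-≡ zero    = a≡0
    allZero (a≡0 ∷ as≡0) .coeffP-≡ (suc i) = allZero as≡0 .coeffP-≡ i

  Laurent-almostCommutativeRing : AlmostCommutativeRing 0ℓ 0ℓ
  Laurent-almostCommutativeRing = fromCommutativeRing Laurent-commutativeRing 0L≟_

  *L-cancelˡ-zero : ∀ e a r .{{_ : NonZero a}} z → (e , a ∷ r) *L z ≈ 0L → z ≈ 0L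
  *L-cancelˡ-zero e a r (f , s) h =
    ,≈0L f (mulP-cancelˡ-zero a r s (,-injectiveʳ (e + f) (≈-trans h (≈-sym (,≈0L (e + f) ≈P-refl)))))

  qpow*[0,p]≈[e,p] : ∀ e p → qpow e *L (0ℤ , p) ≈ (e , p)
  qpow*[0,p]≈[e,p] e p = ,-cong (ℤP.+-identityʳ e) (mulP-identityˡ p)

  [0,1∷r]≈1+q*[0,r] : ∀ r → (0ℤ , 1ℤ ∷ r) ≈ 1L +L (qpow 1ℤ *L (0ℤ , r))
  [0,1∷r]≈1+q*[0,r] r = ,-congʳ 0ℤ (∷-cong refl (≈P-sym (mulP-identityˡ r)))

open import Data.Nat using (zero; suc)
open import Data.Integer as ℤ using (+_; -[1+_])
import Data.Integer.Properties as ℤP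
open import Data.List using ([]; _∷_; _++_; _∷ʳ_)
import Data.List.Properties as List
open import Data.Product using (_,_)
open import Relation.Binary.PropositionalEquality as ≡ using (_≡_)
open import Algebra.Bundles using (CommutativeRing)
open import Data.Integer.Tactic.RingSolver using () renaming (solve-∀ to ℤ-solve-∀)
open import Relation.Binary.Bundles using (Setoid)
open import Level using (0ℓ)
import Relation.Binary.Reasoning.Setoid
open LaurentRing using (coeffwiseL; coeff-≡; Laurent-commutativeRing; Laurent-almostCommutativeRing; *L-cancelˡ-zero; qpow*[0,p]≈[e,p]; [0,1∷r]≈1+q*[0,r])
open CommutativeRing Laurent-commutativeRing
module ≈-Reasoning = Relation.Binary.Reasoning.Setoid setoid
open import Algebra.Properties.AbelianGroup +-abelianGroup using (x∙y⁻¹≈ε⇒x≈y)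
open import Tactic.RingSolver.NonReflective Laurent-almostCommutativeRing using (solve; _⊜_; _⊕_; _⊗_; ⊝_; Κ)

nonZeroDivisor⇒*-cancelˡ : ∀ a → (∀ z → a * z ≈ 0# → z ≈ 0#) → ∀ x y → a * x ≈ a * y → x ≈ y
nonZeroDivisor⇒*-cancelˡ a cancel x y ax≈ay = x∙y⁻¹≈ε⇒x≈y x y (cancel (x - y) (begin
  a * (x - y)          ≈⟨ distribute a x y ⟩
  a * x - a * y        ≈⟨ +-congʳ { - (a * y)} ax≈ay ⟩
  a * y - a * y        ≈⟨ -‿inverseʳ (a * y) ⟩
  0#                   ∎))
  where
  open ≈-Reasoning
  distribute : ∀ a x y → a * (x - y) ≈ a * x - a * y
  distribute = solve 3 (λ a x y → (a ⊗ (x ⊕ ⊝ y)) ⊜ (a ⊗ x ⊕ ⊝ (a ⊗ y))) refl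

-- 2 × 2 matrices

open Mat

infix 4 _≈M_
record _≈M_ (X Y : Mat) : Set where
  constructor entrywise
  field
    ≈₁₁ : a₁₁ X ≈ a₁₁ Y
    ≈₁₂ : a₁₂ X ≈ a₁₂ Y
    ≈₂₁ : a₂₁ X ≈ a₂₁ Y
    ≈₂₂ : a₂₂ X ≈ a₂₂ Y

≈M-setoid : Setoid 0ℓ 0ℓ
≈M-setoid = record
  { Carrier       = Mat
  ; _≈_           = _≈M_
  ; isEquivalence = record
    { refl  = entrywise refl refl refl refl
    ; sym   = λ (entrywise e₁ e₂ e₃ e₄) → entrywise (sym e₁) (sym e₂) (sym e₃) (sym e₄)
    ; trans = λ (entrywise e₁ e₂ e₃ e₄) (entrywise f₁ f₂ f₃ f₄) →
                entrywise (trans e₁ f₁) (trans e₂ f₂) (trans e₃ f₃) (trans e₄ f₄)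
    }
  }

open Setoid ≈M-setoid using () renaming (refl to ≈M-refl; sym to ≈M-sym; trans to ≈M-trans)
module ≈M-Reasoning = Relation.Binary.Reasoning.Setoid ≈M-setoid

·M-cong : ∀ {X X' Y Y'} → X ≈M X' → Y ≈M Y' → X ·M Y ≈M X' ·M Y'
·M-cong {mat _ _ _ _} {mat _ _ _ _} {mat _ _ _ _} {mat _ _ _ _} (entrywise a b c d) (entrywise x y z w) =
  entrywise (+-cong (*-cong a x) (*-cong b z)) (+-cong (*-cong a y) (*-cong b w))
            (+-cong (*-cong c x) (*-cong d z)) (+-cong (*-cong c y) (*-cong d w))

·M-assoc : ∀ X Y Z → (X ·M Y) ·M Z ≈M X ·M (Y ·M Z)
·M-assoc (mat a b c d) (mat p q r s) (mat u v w x) =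
  entrywise (entry a b p q r s u w) (entry a b p q r s v x) (entry c d p q r s u w) (entry c d p q r s v x)
  where
  entry : ∀ a b p q r s u w → (a * p + b * r) * u + (a * q + b * s) * w ≈ a * (p * u + q * w) + b * (r * u + s * w)
  entry = solve 8 (λ a b p q r s u w →
    ((a ⊗ p ⊕ b ⊗ r) ⊗ u ⊕ (a ⊗ q ⊕ b ⊗ s) ⊗ w) ⊜ (a ⊗ (p ⊗ u ⊕ q ⊗ w) ⊕ b ⊗ (r ⊗ u ⊕ s ⊗ w))) refl

1*x+0*y≈x : ∀ x y → 1# * x + 0# * y ≈ x
1*x+0*y≈x = solve 2 (λ x y → (Κ 1# ⊗ x ⊕ Κ 0# ⊗ y) ⊜ x) refl

0*x+1*y≈y : ∀ x y → 0# * x + 1# * y ≈ y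
0*x+1*y≈y = solve 2 (λ x y → (Κ 0# ⊗ x ⊕ Κ 1# ⊗ y) ⊜ y) refl

x*1+y*0≈x : ∀ x y → x * 1# + y * 0# ≈ x
x*1+y*0≈x = solve 2 (λ x y → (x ⊗ Κ 1# ⊕ y ⊗ Κ 0#) ⊜ x) refl

x*0+y*1≈y : ∀ x y → x * 0# + y * 1# ≈ y
x*0+y*1≈y = solve 2 (λ x y → (x ⊗ Κ 0# ⊕ y ⊗ Κ 1#) ⊜ y) refl

·M-identityˡ : ∀ X → idM ·M X ≈M X
·M-identityˡ (mat a b c d) = entrywise (1*x+0*y≈x a c) (1*x+0*y≈x b d) (0*x+1*y≈y a c) (0*x+1*y≈y b d)

·M-identityʳ : ∀ X → X ·M idM ≈M X
·M-identityʳ (mat a b c d) = entrywise (x*1+y*0≈x a b) (x*0+y*1≈y a b) (x*1+y*0≈x c d) (x*0+y*1≈y c d)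

transpose : Mat → Mat
transpose (mat a b c d) = mat a c b d

transpose-·M : ∀ X Y → transpose (X ·M Y) ≈M transpose Y ·M transpose X
transpose-·M (mat a b c d) (mat p q r s) =
  entrywise (entry a p b r) (entry c p d r) (entry a q b s) (entry c q d s)
  where
  entry : ∀ a p b r → a * p + b * r ≈ p * a + r * b
  entry a p b r = +-cong (*-comm a p) (*-comm b r)

Mq-++ : ∀ xs ys → Mq (xs ++ ys) ≈M Mq xs ·M Mq ys
Mq-++ []       ys = ≈M-sym (·M-identityˡ (Mq ys))
Mq-++ (x ∷ xs) ys = ≈M-trans (·M-cong (≈M-refl {M₁ x}) (Mq-++ xs ys)) (≈M-sym (·M-assoc (M₁ x) (Mq xs) (Mq ys)))

Mq-∷ʳ : ∀ xs c → Mq (xs ∷ʳ c) ≈M Mq xs ·M M₁ c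
Mq-∷ʳ xs c = ≈M-trans (Mq-++ xs (c ∷ [])) (·M-cong (≈M-refl {Mq xs}) (·M-identityʳ (M₁ c)))

det : Mat → Laurent
det (mat p r s t) = p * t - r * s

adj : Mat → Mat
adj (mat p r s t) = mat t (- r) (- s) p

tr-cong : ∀ {X Y} → X ≈M Y → tr X ≈ tr Y
tr-cong (entrywise e₁₁ _ _ e₂₂) = +-cong e₁₁ e₂₂

tr-adj-·M-left : ∀ P X → tr (adj P ·M (P ·M X)) ≈ det P * tr X
tr-adj-·M-left (mat p r s t) (mat a b c d) = solve 8 (λ p r s t a b c d →
  (t ⊗ (p ⊗ a ⊕ r ⊗ c) ⊕ ⊝ r ⊗ (s ⊗ a ⊕ t ⊗ c) ⊕ (⊝ s ⊗ (p ⊗ b ⊕ r ⊗ d) ⊕ p ⊗ (s ⊗ b ⊕ t ⊗ d)))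
  ⊜ ((p ⊗ t ⊕ ⊝ (r ⊗ s)) ⊗ (a ⊕ d))) refl p r s t a b c d

tr-adj-·M-right : ∀ P Y → tr (adj P ·M (Y ·M P)) ≈ det P * tr Y
tr-adj-·M-right (mat p r s t) (mat e f g h) = solve 8 (λ p r s t e f g h →
  (t ⊗ (e ⊗ p ⊕ f ⊗ s) ⊕ ⊝ r ⊗ (g ⊗ p ⊕ h ⊗ s) ⊕ (⊝ s ⊗ (e ⊗ r ⊕ f ⊗ t) ⊕ p ⊗ (g ⊗ r ⊕ h ⊗ t)))
  ⊜ ((p ⊗ t ⊕ ⊝ (r ⊗ s)) ⊗ (e ⊕ h))) refl p r s t e f g h

det*tr-invariant : ∀ P X Y → P ·M X ≈M Y ·M P → det P * tr X ≈ det P * tr Y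
det*tr-invariant P X Y PX≈YP = begin
  det P * tr X                   ≈⟨ tr-adj-·M-left P X ⟨
  tr (adj P ·M (P ·M X))         ≈⟨ tr-cong (·M-cong (≈M-refl {adj P}) PX≈YP) ⟩
  tr (adj P ·M (Y ·M P))         ≈⟨ tr-adj-·M-right P Y ⟩
  det P * tr Y                   ∎
  where open ≈-Reasoning

symmetric-intertwines : ∀ p r t x y → x * r + y * t ≈ p →
  mat p r r t ·M transpose (mat x y 1# 0#) ≈M mat x y 1# 0# ·M mat p r r t
symmetric-intertwines p r t x y xr+yt≈p = entrywise
  (+-cong (*-comm p x) (*-comm r y))
  (trans (x*1+y*0≈x p r) (sym xr+yt≈p))
  (trans (+-cong (*-comm r x) (*-comm t y)) (trans xr+yt≈p (sym (1*x+0*y≈x p r))))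
  (trans (x*1+y*0≈x r t) (sym (1*x+0*y≈x r t)))

-- q-integers

q : Laurent
q = qpow ℤ.1ℤ

qpow-+ : ∀ a b → qpow a * qpow b ≈ qpow (a ℤ.+ b)
qpow-+ a b = coeffwiseL λ n → ≡.refl

qpow-cong : ∀ {a b} → a ≡ b → qpow a ≈ qpow b
qpow-cong a≡b = reflexive (≡.cong qpow a≡b)

ones-telescopes : ∀ m → (1# - q) * (ℤ.0ℤ , ones m) + qpow (+ m) ≈ 1#
ones-telescopes zero    = trans (+-congʳ {1#} (zeroʳ (1# - q))) (+-identityˡ 1#)
ones-telescopes (suc m) = begin
  (1# - q) * (ℤ.0ℤ , ℤ.1ℤ ∷ ones m) + q * qpow (+ m)
    ≈⟨ +-congʳ {q * qpow (+ m)} (*-congˡ {1# - q} ([0,1∷r]≈1+q*[0,r] (ones m))) ⟩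
  (1# - q) * (1# + q * N) + q * qpow (+ m)
    ≈⟨ regroup q N (qpow (+ m)) ⟩
  (1# - q) + q * ((1# - q) * N + qpow (+ m))
    ≈⟨ +-congˡ {1# - q} (*-congˡ {q} (ones-telescopes m)) ⟩
  (1# - q) + q * 1#
    ≈⟨ collapse q ⟩
  1# ∎
  where
  open ≈-Reasoning
  N = (ℤ.0ℤ , ones m)
  regroup : ∀ q N Q → (1# - q) * (1# + q * N) + q * Q ≈ (1# - q) + q * ((1# - q) * N + Q)
  regroup = solve 3 (λ q N Q → ((Κ 1# ⊕ ⊝ q) ⊗ (Κ 1# ⊕ q ⊗ N) ⊕ q ⊗ Q) ⊜ ((Κ 1# ⊕ ⊝ q) ⊕ q ⊗ ((Κ 1# ⊕ ⊝ q) ⊗ N ⊕ Q))) refl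
  collapse : ∀ q → (1# - q) + q * 1# ≈ 1#
  collapse = solve 1 (λ q → ((Κ 1# ⊕ ⊝ q) ⊕ q ⊗ Κ 1#) ⊜ Κ 1#) refl

qint-telescopes : ∀ c → (1# - q) * qint c + qpow c ≈ 1#
qint-telescopes (+ m)    = ones-telescopes m
qint-telescopes -[1+ m ] = begin
  (1# - q) * - (c , ones (suc m)) + qpow c
    ≈⟨ +-congʳ {qpow c} (*-congˡ {1# - q} (-‿cong (sym (qpow*[0,p]≈[e,p] c (ones (suc m)))))) ⟩
  (1# - q) * - (qpow c * N) + qpow c
    ≈⟨ factor q (qpow c) N ⟩
  qpow c * (1# - (1# - q) * N)
    ≈⟨ *-congˡ {qpow c} (complement ((1# - q) * N) (qpow (+ suc m)) (ones-telescopes (suc m))) ⟩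
  qpow c * qpow (+ suc m)
    ≈⟨ qpow-+ c (+ suc m) ⟩
  qpow (c ℤ.+ + suc m)
    ≈⟨ qpow-cong (ℤP.+-inverseˡ (+ suc m)) ⟩
  1# ∎
  where
  open ≈-Reasoning
  c = -[1+ m ]
  N = (ℤ.0ℤ , ones (suc m))
  factor : ∀ q Q N → (1# - q) * - (Q * N) + Q ≈ Q * (1# - (1# - q) * N)
  factor = solve 3 (λ q Q N → ((Κ 1# ⊕ ⊝ q) ⊗ ⊝ (Q ⊗ N) ⊕ Q) ⊜ (Q ⊗ (Κ 1# ⊕ ⊝ ((Κ 1# ⊕ ⊝ q) ⊗ N)))) refl
  complement : ∀ a b → a + b ≈ 1# → 1# - a ≈ b
  complement a b a+b≈1 = trans (+-congʳ { - a} (sym a+b≈1)) (cancel a b)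
    where
    cancel : ∀ a b → a + b - a ≈ b
    cancel = solve 2 (λ a b → (a ⊕ b ⊕ ⊝ a) ⊜ b) refl

-- Intertwining M_q with its transpose

intertwiner : Mat
intertwiner = mat 1# (1# - q) (1# - q) (- q)

M₁-intertwined : ∀ c → intertwiner ·M transpose (M₁ c) ≈M M₁ c ·M intertwiner
M₁-intertwined c = symmetric-intertwines 1# (1# - q) (- q) (qint c) Q (begin
  qint c * (1# - q) + Q * - q
    ≈⟨ rearrange (qint c) q (qpow (c ℤ.- ℤ.1ℤ)) ⟩
  (1# - q) * qint c + qpow (c ℤ.- ℤ.1ℤ) * q
    ≈⟨ +-congˡ {(1# - q) * qint c} (trans (qpow-+ (c ℤ.- ℤ.1ℤ) ℤ.1ℤ) (qpow-cong (sub-add c))) ⟩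
  (1# - q) * qint c + qpow c
    ≈⟨ qint-telescopes c ⟩
  1# ∎)
  where
  open ≈-Reasoning
  Q = - qpow (c ℤ.- ℤ.1ℤ)
  rearrange : ∀ x q Q → x * (1# - q) + - Q * - q ≈ (1# - q) * x + Q * q
  rearrange = solve 3 (λ x q Q → (x ⊗ (Κ 1# ⊕ ⊝ q) ⊕ ⊝ Q ⊗ ⊝ q) ⊜ ((Κ 1# ⊕ ⊝ q) ⊗ x ⊕ Q ⊗ q)) refl
  sub-add : ∀ c → c ℤ.- ℤ.1ℤ ℤ.+ ℤ.1ℤ ≡ c
  sub-add = ℤ-solve-∀

Mq-intertwined : ∀ cs → intertwiner ·M transpose (Mq cs) ≈M Mq (reverse cs) ·M intertwiner
Mq-intertwined []       = ≈M-trans (·M-identityʳ intertwiner) (≈M-sym (·M-identityˡ intertwiner))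
Mq-intertwined (c ∷ cs) = begin
  P ·M transpose (M₁ c ·M X)               ≈⟨ ·M-cong (≈M-refl {P}) (transpose-·M (M₁ c) X) ⟩
  P ·M (transpose X ·M transpose (M₁ c))   ≈⟨ ·M-assoc P (transpose X) (transpose (M₁ c)) ⟨
  (P ·M transpose X) ·M transpose (M₁ c)   ≈⟨ ·M-cong (Mq-intertwined cs) (≈M-refl {transpose (M₁ c)}) ⟩
  (Y ·M P) ·M transpose (M₁ c)             ≈⟨ ·M-assoc Y P (transpose (M₁ c)) ⟩
  Y ·M (P ·M transpose (M₁ c))             ≈⟨ ·M-cong (≈M-refl {Y}) (M₁-intertwined c) ⟩
  Y ·M (M₁ c ·M P)                         ≈⟨ ·M-assoc Y (M₁ c) P ⟨
  (Y ·M M₁ c) ·M P                         ≈⟨ ·M-cong (Mq-∷ʳ (reverse cs) c) (≈M-refl {P}) ⟨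
  Mq (reverse cs ∷ʳ c) ·M P                ≡⟨ ≡.cong (λ zs → Mq zs ·M P) (List.unfold-reverse c cs) ⟨
  Mq (reverse (c ∷ cs)) ·M P               ∎
  where
  open ≈M-Reasoning
  P = intertwiner
  X = Mq cs
  Y = Mq (reverse cs)

det-intertwiner : det intertwiner ≈ (ℤ.0ℤ , -[1+ 0 ] ∷ + 1 ∷ -[1+ 0 ] ∷ [])
det-intertwiner = coeffwiseL λ n → ≡.refl

tr-reverse : ∀ cs → tr (Mq cs) ≈ tr (Mq (reverse cs))
tr-reverse cs = nonZeroDivisor⇒*-cancelˡ (det intertwiner) cancel (tr (Mq cs)) (tr (Mq (reverse cs)))
  (det*tr-invariant intertwiner (transpose (Mq cs)) (Mq (reverse cs)) (Mq-intertwined cs))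
  where
  cancel : ∀ z → det intertwiner * z ≈ 0# → z ≈ 0#
  cancel z h = *L-cancelˡ-zero ℤ.0ℤ -[1+ 0 ] (+ 1 ∷ -[1+ 0 ] ∷ []) z (trans (*-congʳ {z} (sym det-intertwiner)) h)

lemma3p8 : (cs : List ℤ) → length cs ≥ 1 →
    tr (Mq cs) ≈L tr (Mq (reverse cs))
lemma3p8 cs _ = tr-reverse cs .coeff-≡
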